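{- Let $C$ be a monotone CNF formula and $x$ a variable of $C$. Let $d=d_x(C)$ and let $c_1,\dots,c_d$ be the clauses containing $x$. Let $w_j=|c_j|-1$, $C_j=(C-\sum_{k\ne j}c_k)+\sum_{k=j+1}^d(c_k-x)$, let $x_{j,1},\dots,x_{j,w_j}$ be the variables of $c_j-x$, and let $C_{j,i}=C_j-c_j-\sum_{k=1}^{i-1}x_{j,k}$. Then $$R(C,x)=\prod_{j=1}^d\left(1-\prod_{i=1}^{w_j}\frac{R(C_{j,i},x_{j,i})}{1+R(C_{j,i},x_{j,i})}\right),$$ where empty products equal $1$.
   Context: A monotone CNF formula is a conjunction of clauses, each a disjunction of variables occurring positively; clauses are treated as sets of variables and a formula as a collection of clauses. $|c|$ is the number of distinct variables in clause $c$, and $d_x(C)$ is the number of clauses of $C$ containing $x$. Notation: $c-x$ is clause $c$ with $x$ removed (occurrence pinned to $0$); $C-c$ removes clause $c$ from $C$; $C+c$ adds clause $c$; $C-x$ removes $x$ from every clause of $C$ (pins $x$ to $0$); $C-x-y=(C-x)-y$, and sums of clauses/variables denote repeated application. $R(C,x)=\mathbb{P}_C(x=0)/\mathbb{P}_C(x=1)$ where $\mathbb{P}_C$ is the uniform distribution over the satisfying assignments of $C$. -}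

module Defs where

open import Data.Bool using (Bool; true; false; _∧_; not)
import Data.Bool as Bool
open import Data.Nat using (ℕ; zero; suc; _∸_)
open import Data.Fin using (Fin; zero; suc; _≟_)
open import Data.List using (List; []; _∷_; _++_; map; filter; filterᵇ; length; concatMap; drop; take; foldr)
open import Data.Integer using (+_)
open import Data.Rational using (ℚ; 0ℚ; 1ℚ; _+_; _-_; _*_; _÷_; _/_; ≢-nonZero)
import Data.Rational as ℚ
open import Data.Bool.ListAction using (any; all)
open import Relation.Nullary using (yes; no; ¬?)
open import Relation.Nullary.Decidable using (⌊_⌋)
open import Data.List.Relation.Unary.Any using (any?)

-- A monotone clause over the variables Fin n: a list of variables
-- (the statement requires it to be duplicate-free, i.e. a set).
Clause : ℕ → Set
Clause n = List (Fin n)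

Formula : ℕ → Set
Formula n = List (Clause n)

Assignment : ℕ → Set
Assignment n = Fin n → Bool

allAssignments : (n : ℕ) → List (Assignment n)
allAssignments zero = (λ ()) ∷ []
allAssignments (suc n) =
  concatMap (λ σ → (λ { zero → false ; (suc i) → σ i })
                 ∷ (λ { zero → true ; (suc i) → σ i }) ∷ [])
            (allAssignments n)

satClause : ∀ {n} → Assignment n → Clause n → Bool
satClause σ c = any σ c

satFormula : ∀ {n} → Assignment n → Formula n → Bool
satFormula σ C = all (satClause σ) C

count : ∀ {n} → Formula n → Fin n → Bool → ℕ
count {n} C x b =
  length (filterᵇ (λ σ → satFormula σ C ∧ ⌊ σ x Bool.≟ b ⌋) (allAssignments n))

-- R(C,x) = P_C(x=0) / P_C(x=1) = #{sat, x=0} / #{sat, x=1}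
-- (convention: 0 when the denominator vanishes; never happens for satisfiable C)
R : ∀ {n} → Formula n → Fin n → ℚ
R C x with count C x true
... | zero  = 0ℚ
... | suc k = (+ count C x false) / suc k

-- r / (1 + r)  (convention 0 if 1 + r = 0, which never happens for r = R(..) ≥ 0)
frac : ℚ → ℚ
frac r with (1ℚ + r) ℚ.≟ 0ℚ
... | yes _ = 0ℚ
... | no ne = _÷_ r (1ℚ + r) {{≢-nonZero ne}}

prod : List ℚ → ℚ
prod = foldr _*_ 1ℚ

_-ᶜ_ : ∀ {n} → Clause n → Fin n → Clause n
c -ᶜ x = filter (λ v → ¬? (v ≟ x)) c

_-ᵛ_ : ∀ {n} → Formula n → Fin n → Formula n
C -ᵛ x = map (_-ᶜ x) C

removeVars : ∀ {n} → Formula n → List (Fin n) → Formula n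
removeVars C []       = C
removeVars C (y ∷ ys) = removeVars (C -ᵛ y) ys

-- the clauses of C not containing x, and c₁,…,c_d: those containing x (in order)
without : ∀ {n} → Formula n → Fin n → Formula n
without C x = filter (λ c → ¬? (any? (x ≟_) c)) C

withX : ∀ {n} → Formula n → Fin n → Formula n
withX C x = filter (λ c → any? (x ≟_) c) C

deg : ∀ {n} → Formula n → Fin n → ℕ
deg C x = length (withX C x)

-- For 0-based j < d (paper's index j+1) with c = c_{j+1} and
-- later = c_{j+2},…,c_d:
--   C_{j+1} - c_{j+1} = (clauses without x) + Σ_{k > j+1} (c_k - x)
-- Here C_{j+1} = (C - Σ_{k≠j+1} c_k) + Σ_{k>j+1}(c_k - x) as a multiset is
-- (clauses without x) + c_{j+1} + Σ_{k>j+1}(c_k - x).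
CjMinusCj : ∀ {n} → Formula n → Fin n → List (Clause n) → Formula n
CjMinusCj C x later = without C x ++ map (_-ᶜ x) later

-- inner product ∏_{i=1}^{w} R(C_{j,i},x_{j,i})/(1+R(C_{j,i},x_{j,i}))
-- where base = C_j - c_j and vs = x_{j,1},…,x_{j,w} (variables of c_j - x),
-- C_{j,i} = base - x_{j,1} - … - x_{j,i-1}.
innerProd : ∀ {n} → Formula n → List (Fin n) → ℚ
innerProd {n} base vs = go base vs
  where
  go : Formula n → List (Fin n) → ℚ
  go D []       = 1ℚ
  go D (v ∷ vs) = frac (R D v) * go (D -ᵛ v) vs

-- outer product over j = 1..d, given the remaining clauses c_j, c_{j+1}, …, c_d
outerProd : ∀ {n} → Formula n → Fin n → List (Clause n) → ℚ
outerProd C x []          = 1ℚ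
outerProd C x (c ∷ later) =
  (1ℚ - innerProd (CjMinusCj C x later) (c -ᶜ x)) * outerProd C x later

rhs : ∀ {n} → Formula n → Fin n → ℚ
rhs C x = outerProd C x (withX C x)

module Submission where

-- The proof is by counting assignments.  Write models D for the number of
-- satisfying assignments of D, count D v b for those with v = b, and
-- falsifying D c for the models of D that falsify the clause c.  Then
--   (1) R/(1+R) for R = R(D,v) is count D v 0 / models D; when count D v 1 = 0
--       this uses monotonicity (count D v 0 ≤ count D v 1);
--   (2) if D does not mention v, toggling v is a bijection on its models, so
--       pinning v to 0 doubles: models (D - v) = 2·count D v 0, and likewise
--       falsifying (D - v) ws = 2·falsifying D (v ∷ ws) when v ∉ ws;
--   (3) adding a clause c removes exactly the models falsifying c.
-- By induction on the clause, (1) and (2) show that the inner product equals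
-- falsifying D c / models D; with (3), induction on c_j,…,c_d shows that the outer
-- product equals models (C - x) / models (clauses without x).  Finally these
-- two counts are 2·count C x 0 and 2·count C x 1, so the product is R(C,x).

open import Defs
open import Data.Bool using (Bool; true; false; _∧_; _∨_; not)
import Data.Bool as Bool
import Data.Bool.Properties as Boolₚ
open import Data.Nat as ℕ using (ℕ; zero; suc; _≤_; _<_; z≤n; s≤s)
import Data.Nat.Properties as ℕₚ
open import Data.Fin using (Fin; zero; suc)
import Data.Fin as Fin
open import Data.List using (List; []; _∷_; _++_; map; filterᵇ; length; concatMap)
open import Data.List.Properties using (++-identityʳ)
open import Data.Integer as ℤ using (+_)
import Data.Integer.Properties as ℤₚ
open import Data.Rational using (ℚ; 0ℚ; 1ℚ; _+_; _-_; _*_; _/_; 1/_; fromℚᵘ; ≢-nonZero)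
import Data.Rational as ℚ
open import Data.Rational.Properties
  using (toℚᵘ-injective; toℚᵘ-fromℚᵘ; toℚᵘ-cong; fromℚᵘ-cong; toℚᵘ-homo-+; toℚᵘ-homo-*;
         *-assoc; *-comm; *-identityˡ; *-identityʳ; *-zeroˡ; *-inverseˡ; *-distribʳ-+; +-comm)
open import Data.Rational.Unnormalised as ℚᵘ using (mkℚᵘ; *≡*)
import Data.Rational.Unnormalised.Properties as ℚᵘₚ
open import Data.Rational.Solver using (module +-*-Solver)
open +-*-Solver using (solve; _:+_; _:*_; _:-_; _:=_; con)
open import Data.List.Relation.Unary.All as All using (All; []; _∷_)
open import Data.List.Relation.Unary.Any using (Any; here; there; any?)
import Data.List.Relation.Unary.All.Properties as Allₚ
open import Data.List.Relation.Unary.Unique.Propositional using (Unique)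
import Data.List.Relation.Unary.Unique.Propositional.Properties as Uniqueₚ
open import Data.List.Relation.Unary.AllPairs using (_∷_)
open import Data.List.Membership.Propositional using (_∈_)
open import Relation.Binary.PropositionalEquality
open import Relation.Nullary using (yes; no; ¬?)
open import Relation.Nullary.Decidable using (⌊_⌋)
open import Data.Empty using (⊥-elim)

-- Natural numbers as rationals.  fromℚᵘ commutes with + and *, which lets
-- us verify identities between casts by integer arithmetic on ℚᵘ.

⟦_⟧ : ℕ → ℚ
⟦ a ⟧ = + a / 1

fromℚᵘ-+ : ∀ p q → fromℚᵘ (p ℚᵘ.+ q) ≡ fromℚᵘ p + fromℚᵘ q
fromℚᵘ-+ p q = toℚᵘ-injective (ℚᵘₚ.≃-trans (toℚᵘ-fromℚᵘ (p ℚᵘ.+ q))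
  (ℚᵘₚ.≃-sym (ℚᵘₚ.≃-trans (toℚᵘ-homo-+ (fromℚᵘ p) (fromℚᵘ q))
                           (ℚᵘₚ.+-cong (toℚᵘ-fromℚᵘ p) (toℚᵘ-fromℚᵘ q)))))

fromℚᵘ-* : ∀ p q → fromℚᵘ (p ℚᵘ.* q) ≡ fromℚᵘ p * fromℚᵘ q
fromℚᵘ-* p q = toℚᵘ-injective (ℚᵘₚ.≃-trans (toℚᵘ-fromℚᵘ (p ℚᵘ.* q))
  (ℚᵘₚ.≃-sym (ℚᵘₚ.≃-trans (toℚᵘ-homo-* (fromℚᵘ p) (fromℚᵘ q))
                           (ℚᵘₚ.*-cong (toℚᵘ-fromℚᵘ p) (toℚᵘ-fromℚᵘ q)))))

⟦⟧-+ : ∀ a b → ⟦ a ℕ.+ b ⟧ ≡ ⟦ a ⟧ + ⟦ b ⟧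
⟦⟧-+ a b = trans (fromℚᵘ-cong {mkℚᵘ (+ (a ℕ.+ b)) 0} {mkℚᵘ (+ a) 0 ℚᵘ.+ mkℚᵘ (+ b) 0} (*≡* cross))
                 (fromℚᵘ-+ (mkℚᵘ (+ a) 0) (mkℚᵘ (+ b) 0))
  where
  cross : + (a ℕ.+ b) ℤ.* + 1 ≡ (+ a ℤ.* + 1 ℤ.+ + b ℤ.* + 1) ℤ.* + 1
  cross = cong (ℤ._* + 1) (trans (ℤₚ.pos-+ a b)
            (sym (cong₂ ℤ._+_ (ℤₚ.*-identityʳ (+ a)) (ℤₚ.*-identityʳ (+ b)))))

⟦⟧-double : ∀ a → ⟦ a ℕ.+ a ⟧ ≡ ⟦ 2 ⟧ * ⟦ a ⟧
⟦⟧-double a = begin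
  ⟦ a ℕ.+ a ⟧        ≡⟨ ⟦⟧-+ a a ⟩
  ⟦ a ⟧ + ⟦ a ⟧      ≡⟨ solve 1 (λ r → r :+ r := (con 1ℚ :+ con 1ℚ) :* r) refl ⟦ a ⟧ ⟩
  (1ℚ + 1ℚ) * ⟦ a ⟧  ≡⟨ cong (_* ⟦ a ⟧) (⟦⟧-+ 1 1) ⟨
  ⟦ 2 ⟧ * ⟦ a ⟧      ∎
  where open ≡-Reasoning

⟦suc⟧≢0 : ∀ m → ⟦ suc m ⟧ ≢ 0ℚ
⟦suc⟧≢0 m eq with ℚᵘₚ.≃-trans (ℚᵘₚ.≃-sym (toℚᵘ-fromℚᵘ (mkℚᵘ (+ suc m) 0)))
                               (ℚᵘₚ.≃-trans (toℚᵘ-cong eq) (toℚᵘ-fromℚᵘ (mkℚᵘ (+ 0) 0)))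
... | *≡* ()

*-cancelˡ-⟦suc⟧ : ∀ m {p q} → ⟦ suc m ⟧ * p ≡ ⟦ suc m ⟧ * q → p ≡ q
*-cancelˡ-⟦suc⟧ m {p} {q} eq = begin
  p               ≡⟨ undo p ⟨
  1/ s * (s * p)  ≡⟨ cong (1/ s *_) eq ⟩
  1/ s * (s * q)  ≡⟨ undo q ⟩
  q               ∎
  where
  open ≡-Reasoning
  s = ⟦ suc m ⟧
  instance _ = ≢-nonZero (⟦suc⟧≢0 m)
  undo : ∀ r → 1/ s * (s * r) ≡ r
  undo r = trans (sym (*-assoc (1/ s) s r)) (trans (cong (_* r) (*-inverseˡ s)) (*-identityˡ r))

ratio : ℕ → ℕ → ℚ
ratio a zero    = 0ℚ
ratio a (suc k) = + a / suc k

ratio-*-denominator : ∀ a k → ratio a (suc k) * ⟦ suc k ⟧ ≡ ⟦ a ⟧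
ratio-*-denominator a k =
  trans (sym (fromℚᵘ-* (mkℚᵘ (+ a) k) (mkℚᵘ (+ suc k) 0)))
        (fromℚᵘ-cong {mkℚᵘ (+ a) k ℚᵘ.* mkℚᵘ (+ suc k) 0} {mkℚᵘ (+ a) 0} (*≡* cross))
  where
  cross : (+ a ℤ.* + suc k) ℤ.* + 1 ≡ + a ℤ.* + (suc k ℕ.* 1)
  cross = trans (ℤₚ.*-assoc (+ a) (+ suc k) (+ 1)) (cong (+ a ℤ.*_) (sym (ℤₚ.pos-* (suc k) 1)))

ratio-unique : ∀ a b {q} → 0 < b → q * ⟦ b ⟧ ≡ ⟦ a ⟧ → ratio a b ≡ q
ratio-unique a (suc k) {q} _ eq = *-cancelˡ-⟦suc⟧ k (begin
  ⟦ suc k ⟧ * ratio a (suc k)  ≡⟨ *-comm ⟦ suc k ⟧ (ratio a (suc k)) ⟩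
  ratio a (suc k) * ⟦ suc k ⟧  ≡⟨ ratio-*-denominator a k ⟩
  ⟦ a ⟧                        ≡⟨ eq ⟨
  q * ⟦ suc k ⟧                ≡⟨ *-comm q ⟦ suc k ⟧ ⟩
  ⟦ suc k ⟧ * q                ∎)
  where open ≡-Reasoning

one+ratio : ∀ a k → (1ℚ + ratio a (suc k)) * ⟦ suc k ⟧ ≡ ⟦ a ℕ.+ suc k ⟧
one+ratio a k = begin
  (1ℚ + ratio a (suc k)) * ⟦ suc k ⟧                  ≡⟨ *-distribʳ-+ ⟦ suc k ⟧ 1ℚ (ratio a (suc k)) ⟩
  1ℚ * ⟦ suc k ⟧ + ratio a (suc k) * ⟦ suc k ⟧        ≡⟨ cong₂ _+_ (*-identityˡ ⟦ suc k ⟧) (ratio-*-denominator a k) ⟩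
  ⟦ suc k ⟧ + ⟦ a ⟧                                  ≡⟨ +-comm ⟦ suc k ⟧ ⟦ a ⟧ ⟩
  ⟦ a ⟧ + ⟦ suc k ⟧                                  ≡⟨ ⟦⟧-+ a (suc k) ⟨
  ⟦ a ℕ.+ suc k ⟧                                    ∎
  where open ≡-Reasoning

-- r/(1+r) for r = a/b is a/(a+b); when b = 0 this needs a = 0, i.e. a ≤ b.
frac-ratio : ∀ a b → a ≤ b → frac (ratio a b) * ⟦ a ℕ.+ b ⟧ ≡ ⟦ a ⟧
frac-ratio zero zero z≤n = refl
frac-ratio a (suc k) _ with (1ℚ + ratio a (suc k)) ℚ.≟ 0ℚ
... | yes 1+r≡0 = ⊥-elim (⟦suc⟧≢0 (a ℕ.+ k) (begin
  ⟦ suc (a ℕ.+ k) ⟧                        ≡⟨ cong ⟦_⟧ (ℕₚ.+-suc a k) ⟨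
  ⟦ a ℕ.+ suc k ⟧                          ≡⟨ one+ratio a k ⟨
  (1ℚ + ratio a (suc k)) * ⟦ suc k ⟧       ≡⟨ cong (_* ⟦ suc k ⟧) 1+r≡0 ⟩
  0ℚ * ⟦ suc k ⟧                           ≡⟨ *-zeroˡ ⟦ suc k ⟧ ⟩
  0ℚ                                       ∎))
  where open ≡-Reasoning
... | no 1+r≢0 = begin
  (r * 1/ s) * ⟦ a ℕ.+ suc k ⟧        ≡⟨ cong ((r * 1/ s) *_) (one+ratio a k) ⟨
  (r * 1/ s) * (s * ⟦ suc k ⟧)        ≡⟨ solve 4 (λ r i s d → (r :* i) :* (s :* d) := (r :* d) :* (i :* s)) refl r (1/ s) s ⟦ suc k ⟧ ⟩
  (r * ⟦ suc k ⟧) * (1/ s * s)        ≡⟨ cong₂ _*_ (ratio-*-denominator a k) (*-inverseˡ s) ⟩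
  ⟦ a ⟧ * 1ℚ                          ≡⟨ *-identityʳ ⟦ a ⟧ ⟩
  ⟦ a ⟧                               ∎
  where
  open ≡-Reasoning
  r = ratio a (suc k)
  s = 1ℚ + r
  instance _ = ≢-nonZero 1+r≢0

module _ {A : Set} where

  length-filterᵇ-cong : ∀ {p q : A → Bool} → (∀ a → p a ≡ q a) →
    ∀ xs → length (filterᵇ p xs) ≡ length (filterᵇ q xs)
  length-filterᵇ-cong e [] = refl
  length-filterᵇ-cong {p} {q} e (x ∷ xs) rewrite e x with q x
  ... | true  = cong suc (length-filterᵇ-cong e xs)
  ... | false = length-filterᵇ-cong e xs

  length-filterᵇ-mono : ∀ {p q : A → Bool} → (∀ a → p a ≡ true → q a ≡ true) →
    ∀ xs → length (filterᵇ p xs) ≤ length (filterᵇ q xs)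
  length-filterᵇ-mono i [] = z≤n
  length-filterᵇ-mono {p} {q} i (x ∷ xs) with p x in px | q x in qx
  ... | true  | true  = s≤s (length-filterᵇ-mono i xs)
  ... | false | true  = ℕₚ.m≤n⇒m≤1+n (length-filterᵇ-mono i xs)
  ... | false | false = length-filterᵇ-mono i xs
  ... | true  | false with () ← trans (sym (i x px)) qx

  length-filterᵇ-head : ∀ (p : A → Bool) y ys → p y ≡ true → 0 < length (filterᵇ p (y ∷ ys))
  length-filterᵇ-head p y ys py rewrite py = s≤s z≤n

  length-filterᵇ-split : ∀ (p q : A → Bool) xs → length (filterᵇ p xs) ≡
    length (filterᵇ (λ a → p a ∧ not (q a)) xs) ℕ.+ length (filterᵇ (λ a → p a ∧ q a) xs)
  length-filterᵇ-split p q [] = refl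
  length-filterᵇ-split p q (x ∷ xs) with p x | q x
  ... | true  | true  = trans (cong suc (length-filterᵇ-split p q xs)) (sym (ℕₚ.+-suc _ _))
  ... | true  | false = cong suc (length-filterᵇ-split p q xs)
  ... | false | _     = length-filterᵇ-split p q xs

  -- Filtering the list f a₁, g a₁, f a₂, g a₂, …  (the shape of allAssignments (suc n)).
  length-filterᵇ-pairs : ∀ {B : Set} (p : B → Bool) (f g : A → B) xs →
    length (filterᵇ p (concatMap (λ a → f a ∷ g a ∷ []) xs)) ≡
    length (filterᵇ (λ a → p (f a)) xs) ℕ.+ length (filterᵇ (λ a → p (g a)) xs)
  length-filterᵇ-pairs p f g [] = refl
  length-filterᵇ-pairs p f g (x ∷ xs) with p (f x)
  ... | true  with p (g x)
  ...   | true  = cong suc (trans (cong suc (length-filterᵇ-pairs p f g xs)) (sym (ℕₚ.+-suc _ _)))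
  ...   | false = cong suc (length-filterᵇ-pairs p f g xs)
  length-filterᵇ-pairs p f g (x ∷ xs) | false with p (g x)
  ...   | true  = trans (cong suc (length-filterᵇ-pairs p f g xs)) (sym (ℕₚ.+-suc _ _))
  ...   | false = length-filterᵇ-pairs p f g xs

-- Counting assignments.  Without function extensionality, predicates on
-- assignments must be shown to respect pointwise equality (_≗_) explicitly.

Extensional : ∀ {n} → (Assignment n → Bool) → Set
Extensional p = ∀ {σ τ} → σ ≗ τ → p σ ≡ p τ

#_ : ∀ {n} → (Assignment n → Bool) → ℕ
#_ {n} p = length (filterᵇ p (allAssignments n))

#-cong : ∀ {n} {p q : Assignment n → Bool} → (∀ σ → p σ ≡ q σ) → # p ≡ # q
#-cong {n} e = length-filterᵇ-cong e (allAssignments n)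

#-mono : ∀ {n} {p q : Assignment n → Bool} → (∀ σ → p σ ≡ true → q σ ≡ true) → # p ≤ # q
#-mono {n} i = length-filterᵇ-mono i (allAssignments n)

#-split : ∀ {n} (p q : Assignment n → Bool) →
  # p ≡ # (λ σ → p σ ∧ not (q σ)) ℕ.+ # (λ σ → p σ ∧ q σ)
#-split {n} p q = length-filterᵇ-split p q (allAssignments n)

_◂_ : ∀ {n} → Bool → Assignment n → Assignment (suc n)
(b ◂ τ) zero    = b
(b ◂ τ) (suc i) = τ i

◂-cong : ∀ {n} b {σ τ : Assignment n} → σ ≗ τ → (b ◂ σ) ≗ (b ◂ τ)
◂-cong b e zero    = refl
◂-cong b e (suc i) = e i

#-suc : ∀ {n} (p : Assignment (suc n) → Bool) → Extensional p →
  # p ≡ # (λ τ → p (false ◂ τ)) ℕ.+ # (λ τ → p (true ◂ τ))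
#-suc {n} p ext = trans (length-filterᵇ-pairs p _ _ (allAssignments n))
  (cong₂ ℕ._+_ (#-cong (λ τ → ext {τ = false ◂ τ} λ { zero → refl ; (suc i) → refl }))
               (#-cong (λ τ → ext {τ = true ◂ τ} λ { zero → refl ; (suc i) → refl })))

#-positive : ∀ {n} (p : Assignment n → Bool) → Extensional p →
  ∀ τ → p τ ≡ true → 0 < # p
#-positive {zero} p ext τ pτ = length-filterᵇ-head p _ [] (trans (ext (λ ())) pτ)
#-positive {suc n} p ext τ pτ = ℕₚ.<-≤-trans both (ℕₚ.≤-reflexive (sym (#-suc p ext)))
  where
  pτ′ : p (τ zero ◂ (λ i → τ (suc i))) ≡ true
  pτ′ = trans (ext λ { zero → refl ; (suc i) → refl }) pτ
  half : ∀ b → b ≡ τ zero → 0 < # (λ τ′ → p (b ◂ τ′))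
  half _ refl = #-positive _ (λ e → ext (◂-cong (τ zero) e)) _ pτ′
  both : 0 < # (λ τ′ → p (false ◂ τ′)) ℕ.+ # (λ τ′ → p (true ◂ τ′))
  both with τ zero in τ₀
  ... | false = ℕₚ.<-≤-trans (half false (sym τ₀)) (ℕₚ.m≤m+n _ _)
  ... | true  = ℕₚ.<-≤-trans (half true (sym τ₀)) (ℕₚ.m≤n+m _ _)

toggle : ∀ {n} → Fin n → Assignment n → Assignment n
toggle zero    σ zero    = not (σ zero)
toggle zero    σ (suc i) = σ (suc i)
toggle (suc v) σ zero    = σ zero
toggle (suc v) σ (suc i) = toggle v (λ j → σ (suc j)) i

toggle-cong : ∀ {n} (v : Fin n) {σ τ} → σ ≗ τ → toggle v σ ≗ toggle v τ
toggle-cong zero    e zero    = cong not (e zero)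
toggle-cong zero    e (suc i) = e (suc i)
toggle-cong (suc v) e zero    = e zero
toggle-cong (suc v) e (suc i) = toggle-cong v (λ j → e (suc j)) i

toggle-self : ∀ {n} (v : Fin n) σ → toggle v σ v ≡ not (σ v)
toggle-self zero    σ = refl
toggle-self (suc v) σ = toggle-self v (λ j → σ (suc j))

toggle-other : ∀ {n} (v : Fin n) σ {i} → v ≢ i → toggle v σ i ≡ σ i
toggle-other zero    σ {zero}  v≢i = ⊥-elim (v≢i refl)
toggle-other zero    σ {suc i} v≢i = refl
toggle-other (suc v) σ {zero}  v≢i = refl
toggle-other (suc v) σ {suc i} v≢i = toggle-other v (λ j → σ (suc j)) (λ v≡i → v≢i (cong suc v≡i))

toggle-zero-◂ : ∀ {n} b (τ : Assignment n) → (not b ◂ τ) ≗ toggle zero (b ◂ τ)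
toggle-zero-◂ b τ zero    = refl
toggle-zero-◂ b τ (suc i) = refl

toggle-suc-◂ : ∀ {n} (v : Fin n) b τ → (b ◂ toggle v τ) ≗ toggle (suc v) (b ◂ τ)
toggle-suc-◂ v b τ zero    = refl
toggle-suc-◂ v b τ (suc i) = refl

-- Toggling a variable is a bijection on assignments, so it preserves counts.
#-toggle : ∀ {n} (v : Fin n) (p : Assignment n → Bool) → Extensional p →
  # p ≡ # (λ σ → p (toggle v σ))
#-toggle {suc n} zero p ext = begin
  # p                                                   ≡⟨ #-suc p ext ⟩
  # (λ τ → p (false ◂ τ)) ℕ.+ # (λ τ → p (true ◂ τ))   ≡⟨ ℕₚ.+-comm (# λ τ → p (false ◂ τ)) _ ⟩
  # (λ τ → p (true ◂ τ)) ℕ.+ # (λ τ → p (false ◂ τ))   ≡⟨ cong₂ ℕ._+_ (#-cong (λ τ → ext (toggle-zero-◂ false τ)))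
                                                                     (#-cong (λ τ → ext (toggle-zero-◂ true τ))) ⟩
  # (λ τ → p (toggle zero (false ◂ τ))) ℕ.+ # (λ τ → p (toggle zero (true ◂ τ)))
                                                        ≡⟨ #-suc _ (λ e → ext (toggle-cong zero e)) ⟨
  # (λ σ → p (toggle zero σ))                           ∎
  where open ≡-Reasoning
#-toggle {suc n} (suc v) p ext = begin
  # p                                                   ≡⟨ #-suc p ext ⟩
  # (λ τ → p (false ◂ τ)) ℕ.+ # (λ τ → p (true ◂ τ))   ≡⟨ cong₂ ℕ._+_ (#-toggle v _ (λ e → ext (◂-cong false e)))
                                                                     (#-toggle v _ (λ e → ext (◂-cong true e))) ⟩
  # (λ τ → p (false ◂ toggle v τ)) ℕ.+ # (λ τ → p (true ◂ toggle v τ))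
                                                        ≡⟨ cong₂ ℕ._+_ (#-cong (λ τ → ext (toggle-suc-◂ v false τ)))
                                                                       (#-cong (λ τ → ext (toggle-suc-◂ v true τ))) ⟩
  # (λ τ → p (toggle (suc v) (false ◂ τ))) ℕ.+ # (λ τ → p (toggle (suc v) (true ◂ τ)))
                                                        ≡⟨ #-suc _ (λ e → ext (toggle-cong (suc v) e)) ⟨
  # (λ σ → p (toggle (suc v) σ))                        ∎
  where open ≡-Reasoning

ToggleInvariant : ∀ {n} → Fin n → (Assignment n → Bool) → Set
ToggleInvariant v p = ∀ σ → p (toggle v σ) ≡ p σ

#-symmetric : ∀ {n} (v : Fin n) (p : Assignment n → Bool) → Extensional p → ToggleInvariant v p →
  # (λ σ → p σ ∧ σ v) ≡ # (λ σ → p σ ∧ not (σ v))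
#-symmetric v p ext inv = trans (#-toggle v _ (λ e → cong₂ _∧_ (ext e) (e v)))
  (#-cong (λ σ → cong₂ _∧_ (inv σ) (toggle-self v σ)))

#-double : ∀ {n} (v : Fin n) (p : Assignment n → Bool) → Extensional p → ToggleInvariant v p →
  # p ≡ # (λ σ → p σ ∧ not (σ v)) ℕ.+ # (λ σ → p σ ∧ not (σ v))
#-double v p ext inv =
  trans (#-split p (λ σ → σ v)) (cong (# (λ σ → p σ ∧ not (σ v)) ℕ.+_) (#-symmetric v p ext inv))

-- Semantics of formulas.

satClause-cong : ∀ {n} (c : Clause n) → Extensional (λ σ → satClause σ c)
satClause-cong []      e = refl
satClause-cong (y ∷ c) e = cong₂ _∨_ (e y) (satClause-cong c e)

satFormula-cong : ∀ {n} (D : Formula n) → Extensional (λ σ → satFormula σ D)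
satFormula-cong []      e = refl
satFormula-cong (c ∷ D) e = cong₂ _∧_ (satClause-cong c e) (satFormula-cong D e)

satFormula-++ : ∀ {n} σ (A B : Formula n) → satFormula σ (A ++ B) ≡ satFormula σ A ∧ satFormula σ B
satFormula-++ σ []      B = refl
satFormula-++ σ (c ∷ A) B =
  trans (cong (satClause σ c ∧_) (satFormula-++ σ A B)) (sym (Boolₚ.∧-assoc (satClause σ c) _ _))

Avoids : ∀ {n} → Fin n → Formula n → Set
Avoids v D = All (All (v ≢_)) D

satClause-toggle : ∀ {n} (v : Fin n) (c : Clause n) → All (v ≢_) c →
  ToggleInvariant v (λ σ → satClause σ c)
satClause-toggle v []      []          σ = refl
satClause-toggle v (y ∷ c) (v≢y ∷ vc) σ = cong₂ _∨_ (toggle-other v σ v≢y) (satClause-toggle v c vc σ)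

satFormula-toggle : ∀ {n} (v : Fin n) (D : Formula n) → Avoids v D →
  ToggleInvariant v (λ σ → satFormula σ D)
satFormula-toggle v []      []        σ = refl
satFormula-toggle v (c ∷ D) (vc ∷ vD) σ = cong₂ _∧_ (satClause-toggle v c vc σ) (satFormula-toggle v D vD σ)

satFormula-pin : ∀ {n} (v : Fin n) σ → σ v ≡ false → (D : Formula n) →
  satFormula σ (D -ᵛ v) ≡ satFormula σ D
satFormula-pin v σ σv≡0 []      = refl
satFormula-pin v σ σv≡0 (c ∷ D) = cong₂ _∧_ (clause c) (satFormula-pin v σ σv≡0 D)
  where
  clause : ∀ c → satClause σ (c -ᶜ v) ≡ satClause σ c
  clause []      = refl
  clause (y ∷ c) with y Fin.≟ v
  ... | yes refl = trans (clause c) (cong (_∨ satClause σ c) (sym σv≡0))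
  ... | no  _    = cong (σ y ∨_) (clause c)

avoids-pin : ∀ {n} (v : Fin n) (D : Formula n) → Avoids v (D -ᵛ v)
avoids-pin v D = Allₚ.map⁺ (All.tabulate {xs = D} λ {c} _ →
  All.map (λ y≢v v≡y → y≢v (sym v≡y)) (Allₚ.all-filter (λ y → ¬? (y Fin.≟ v)) c))

satFormula-mono : ∀ {n} {σ τ : Assignment n} → (∀ i → σ i ≡ true → τ i ≡ true) →
  ∀ D → satFormula σ D ≡ true → satFormula τ D ≡ true
satFormula-mono {σ = σ} {τ} σ≤τ = formula
  where
  clause : ∀ c → satClause σ c ≡ true → satClause τ c ≡ true
  clause (y ∷ c) sat with σ y in σy
  ... | true  = cong (_∨ satClause τ c) (σ≤τ y σy)
  ... | false = trans (cong (τ y ∨_) (clause c sat)) (Boolₚ.∨-zeroʳ (τ y))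
  formula : ∀ D → satFormula σ D ≡ true → satFormula τ D ≡ true
  formula []      _ = refl
  formula (c ∷ D) sat with satClause σ c in sc | satFormula σ D in sD
  formula (c ∷ D) refl | true | true = cong₂ _∧_ (clause c sc) (formula D sD)

satFormula-allTrue : ∀ {n} (D : Formula n) → All (_≢ []) D → satFormula (λ _ → true) D ≡ true
satFormula-allTrue []            []          = refl
satFormula-allTrue ([] ∷ D)      (c≢[] ∷ _)  = ⊥-elim (c≢[] refl)
satFormula-allTrue ((y ∷ c) ∷ D) (_ ∷ D≢[]) = satFormula-allTrue D D≢[]

satFormula-split : ∀ {n} σ (x : Fin n) (C : Formula n) →
  satFormula σ C ≡ satFormula σ (without C x) ∧ satFormula σ (withX C x)
satFormula-split σ x [] = refl
satFormula-split σ x (c ∷ C) with any? (x Fin.≟_) c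
... | yes _ = trans (cong (satClause σ c ∧_) (satFormula-split σ x C))
                    (interchange (satClause σ c) (satFormula σ (without C x)) _)
  where
  interchange : ∀ a b d → a ∧ (b ∧ d) ≡ b ∧ (a ∧ d)
  interchange true  b d = refl
  interchange false b d = sym (Boolₚ.∧-zeroʳ b)
... | no  _ = trans (cong (satClause σ c ∧_) (satFormula-split σ x C))
                    (sym (Boolₚ.∧-assoc (satClause σ c) _ _))

satFormula-withX : ∀ {n} σ (x : Fin n) (C : Formula n) → σ x ≡ true → satFormula σ (withX C x) ≡ true
satFormula-withX σ x C σx≡1 = clauses (withX C x) (Allₚ.all-filter (λ c → any? (x Fin.≟_) c) C)
  where
  clause : ∀ c → Any (x ≡_) c → satClause σ c ≡ true
  clause (y ∷ c) (here refl) = cong (_∨ satClause σ c) σx≡1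
  clause (y ∷ c) (there x∈c) = trans (cong (σ y ∨_) (clause c x∈c)) (Boolₚ.∨-zeroʳ (σ y))
  clauses : ∀ D → All (Any (x ≡_)) D → satFormula σ D ≡ true
  clauses []      []          = refl
  clauses (c ∷ D) (x∈c ∷ x∈D) = cong₂ _∧_ (clause c x∈c) (clauses D x∈D)

avoids-without : ∀ {n} (x : Fin n) (C : Formula n) → Avoids x (without C x)
avoids-without x C = All.map (Allₚ.¬Any⇒All¬ _) (Allₚ.all-filter (λ c → ¬? (any? (x Fin.≟_) c)) C)

-- Counting models.

models : ∀ {n} → Formula n → ℕ
models D = # (λ σ → satFormula σ D)

falsifying : ∀ {n} → Formula n → Clause n → ℕ
falsifying D c = # (λ σ → satFormula σ D ∧ not (satClause σ c))

count-false : ∀ {n} (D : Formula n) v → count D v false ≡ # (λ σ → satFormula σ D ∧ not (σ v))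
count-false D v = #-cong λ σ → cong (satFormula σ D ∧_) (is-false (σ v))
  where
  is-false : ∀ b → ⌊ b Bool.≟ false ⌋ ≡ not b
  is-false true  = refl
  is-false false = refl

count-true : ∀ {n} (D : Formula n) v → count D v true ≡ # (λ σ → satFormula σ D ∧ σ v)
count-true D v = #-cong λ σ → cong (satFormula σ D ∧_) (is-true (σ v))
  where
  is-true : ∀ b → ⌊ b Bool.≟ true ⌋ ≡ b
  is-true true  = refl
  is-true false = refl

count-split : ∀ {n} (D : Formula n) v → models D ≡ count D v false ℕ.+ count D v true
count-split D v = trans (#-split _ (λ σ → σ v)) (sym (cong₂ ℕ._+_ (count-false D v) (count-true D v)))

count-agree : ∀ {n} (D E : Formula n) v b → (∀ σ → σ v ≡ b → satFormula σ D ≡ satFormula σ E) →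
  count D v b ≡ count E v b
count-agree D E v b agree = #-cong pointwise
  where
  pointwise : ∀ σ → satFormula σ D ∧ ⌊ σ v Bool.≟ b ⌋ ≡ satFormula σ E ∧ ⌊ σ v Bool.≟ b ⌋
  pointwise σ with σ v Bool.≟ b
  ... | yes σv≡b = cong (_∧ true) (agree σ σv≡b)
  ... | no  _    = trans (Boolₚ.∧-zeroʳ _) (sym (Boolₚ.∧-zeroʳ _))

-- Monotonicity of the formula: toggling v from 0 to 1 maps models to models,
-- so #{v = 0} ≤ #{v = 1}.
count-mono : ∀ {n} (D : Formula n) v → count D v false ≤ count D v true
count-mono D v = begin
  count D v false                                                ≡⟨ count-false D v ⟩
  # (λ σ → satFormula σ D ∧ not (σ v))                           ≡⟨ #-toggle v _ ext ⟩
  # (λ σ → satFormula (toggle v σ) D ∧ not (toggle v σ v))       ≤⟨ #-mono raise ⟩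
  # (λ σ → satFormula σ D ∧ σ v)                                 ≡⟨ count-true D v ⟨
  count D v true                                                 ∎
  where
  open ℕₚ.≤-Reasoning
  ext : Extensional (λ σ → satFormula σ D ∧ not (σ v))
  ext e = cong₂ _∧_ (satFormula-cong D e) (cong not (e v))
  below : ∀ σ → σ v ≡ true → ∀ i → toggle v σ i ≡ true → σ i ≡ true
  below σ σv≡1 i with v Fin.≟ i
  ... | yes refl = λ _ → σv≡1
  ... | no  v≢i  = trans (sym (toggle-other v σ v≢i))
  raise : ∀ σ → satFormula (toggle v σ) D ∧ not (toggle v σ v) ≡ true → satFormula σ D ∧ σ v ≡ true
  raise σ sat rewrite toggle-self v σ with satFormula (toggle v σ) D in s | σ v in σv
  ... | true | true = cong (_∧ true) (satFormula-mono (below σ σv) D s)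

models-avoiding : ∀ {n} (v : Fin n) (D : Formula n) → Avoids v D →
  ∀ b → models D ≡ count D v b ℕ.+ count D v b
models-avoiding v D vD b = trans (count-split D v) (halves b)
  where
  symmetric : count D v true ≡ count D v false
  symmetric = begin
    count D v true                         ≡⟨ count-true D v ⟩
    # (λ σ → satFormula σ D ∧ σ v)         ≡⟨ #-symmetric v _ (satFormula-cong D) (satFormula-toggle v D vD) ⟩
    # (λ σ → satFormula σ D ∧ not (σ v))   ≡⟨ count-false D v ⟨
    count D v false                        ∎
    where open ≡-Reasoning
  halves : ∀ b → count D v false ℕ.+ count D v true ≡ count D v b ℕ.+ count D v b
  halves false = cong (count D v false ℕ.+_) symmetric
  halves true  = cong (ℕ._+ count D v true) (sym symmetric)

models-pin : ∀ {n} (v : Fin n) (D : Formula n) → models (D -ᵛ v) ≡ count D v false ℕ.+ count D v false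
models-pin v D = trans (models-avoiding v (D -ᵛ v) (avoids-pin v D) false)
  (cong₂ ℕ._+_ same same)
  where
  same : count (D -ᵛ v) v false ≡ count D v false
  same = count-agree (D -ᵛ v) D v false (λ σ σv≡0 → satFormula-pin v σ σv≡0 D)

falsifying-pin : ∀ {n} (v : Fin n) (D : Formula n) ws → All (v ≢_) ws →
  falsifying (D -ᵛ v) ws ≡ falsifying D (v ∷ ws) ℕ.+ falsifying D (v ∷ ws)
falsifying-pin v D ws v∉ws = trans (#-double v p ext inv) (cong₂ ℕ._+_ same same)
  where
  p : Assignment _ → Bool
  p σ = satFormula σ (D -ᵛ v) ∧ not (satClause σ ws)
  ext : Extensional p
  ext e = cong₂ _∧_ (satFormula-cong (D -ᵛ v) e) (cong not (satClause-cong ws e))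
  inv : ToggleInvariant v p
  inv σ = cong₂ _∧_ (satFormula-toggle v (D -ᵛ v) (avoids-pin v D) σ)
                    (cong not (satClause-toggle v ws v∉ws σ))
  pointwise : ∀ σ → p σ ∧ not (σ v) ≡ satFormula σ D ∧ not (σ v ∨ satClause σ ws)
  pointwise σ with σ v in σv
  ... | true  = trans (Boolₚ.∧-zeroʳ _) (sym (Boolₚ.∧-zeroʳ _))
  ... | false = trans (Boolₚ.∧-identityʳ _) (cong (_∧ not (satClause σ ws)) (satFormula-pin v σ σv D))
  same = #-cong pointwise

falsifying-[] : ∀ {n} (D : Formula n) → falsifying D [] ≡ models D
falsifying-[] D = #-cong λ σ → Boolₚ.∧-identityʳ (satFormula σ D)

models-add-clause : ∀ {n} (W M : Formula n) c →
  models (W ++ M) ≡ falsifying (W ++ M) c ℕ.+ models (W ++ c ∷ M)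
models-add-clause W M c = trans (#-split _ (λ σ → satClause σ c))
  (cong (falsifying (W ++ M) c ℕ.+_) (#-cong pointwise))
  where
  pointwise : ∀ σ → satFormula σ (W ++ M) ∧ satClause σ c ≡ satFormula σ (W ++ c ∷ M)
  pointwise σ rewrite satFormula-++ σ W M | satFormula-++ σ W (c ∷ M) =
    rearrange (satFormula σ W) (satFormula σ M) (satClause σ c)
    where
    rearrange : ∀ a b d → (a ∧ b) ∧ d ≡ a ∧ (d ∧ b)
    rearrange a b d = trans (Boolₚ.∧-assoc a b d) (cong (a ∧_) (Boolₚ.∧-comm b d))

-- A formula without empty clauses has a model with x = 1 (all ones).
count-positive : ∀ {n} (C : Formula n) x → All (_≢ []) C → 0 < count C x true
count-positive C x C≢[] = #-positive _ ext (λ _ → true) (cong (_∧ true) (satFormula-allTrue C C≢[]))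
  where
  ext : Extensional (λ σ → satFormula σ C ∧ ⌊ σ x Bool.≟ true ⌋)
  ext e = cong₂ _∧_ (satFormula-cong C e) (cong (λ b → ⌊ b Bool.≟ true ⌋) (e x))

models-without : ∀ {n} (C : Formula n) x → models (without C x) ≡ count C x true ℕ.+ count C x true
models-without C x = trans (models-avoiding x W (avoids-without x C) true) (cong₂ ℕ._+_ same same)
  where
  W = without C x
  same : count W x true ≡ count C x true
  same = count-agree W C x true λ σ σx≡1 → sym (trans (satFormula-split σ x C)
    (trans (cong (satFormula σ W ∧_) (satFormula-withX σ x C σx≡1)) (Boolₚ.∧-identityʳ _)))

models-pin-all : ∀ {n} (C : Formula n) x →
  models (CjMinusCj C x (withX C x)) ≡ count C x false ℕ.+ count C x false
models-pin-all C x = trans (models-avoiding x D avoids false) (cong₂ ℕ._+_ same same)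
  where
  D = CjMinusCj C x (withX C x)
  avoids : Avoids x D
  avoids = Allₚ.++⁺ (avoids-without x C) (avoids-pin x (withX C x))
  same : count D x false ≡ count C x false
  same = count-agree D C x false λ σ σx≡0 → trans (satFormula-++ σ (without C x) _)
    (trans (cong (satFormula σ (without C x) ∧_) (satFormula-pin x σ σx≡0 (withX C x)))
           (sym (satFormula-split σ x C)))

-- The products of the theorem, interpreted as probabilities.

R≡ratio : ∀ {n} (D : Formula n) v → R D v ≡ ratio (count D v false) (count D v true)
R≡ratio D v with count D v true
... | zero  = refl
... | suc k = refl

frac-R : ∀ {n} (D : Formula n) v → frac (R D v) * ⟦ models D ⟧ ≡ ⟦ count D v false ⟧
frac-R D v = begin
  frac (R D v) * ⟦ models D ⟧                 ≡⟨ cong₂ (λ r m → frac r * ⟦ m ⟧) (R≡ratio D v) (count-split D v) ⟩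
  frac (ratio a b) * ⟦ a ℕ.+ b ⟧              ≡⟨ frac-ratio a b (count-mono D v) ⟩
  ⟦ a ⟧                                       ∎
  where
  open ≡-Reasoning
  a = count D v false
  b = count D v true

-- The inner product for D and the variables ws of a clause is the probability
-- that ws is falsified: factor i is the probability that x_{j,i} = 0 given
-- x_{j,1} = … = x_{j,i-1} = 0, computed in the formula with those pinned.
innerProd-falsifying : ∀ {n} (D : Formula n) ws → Unique ws →
  innerProd D ws * ⟦ models D ⟧ ≡ ⟦ falsifying D ws ⟧
innerProd-falsifying D []       _             = trans (*-identityˡ ⟦ models D ⟧) (cong ⟦_⟧ (sym (falsifying-[] D)))
innerProd-falsifying D (v ∷ ws) (v∉ws ∷ uws) = *-cancelˡ-⟦suc⟧ 1 (begin
  ⟦ 2 ⟧ * (f * g * ⟦ models D ⟧)        ≡⟨ cong (⟦ 2 ⟧ *_) (solve 3 (λ f g m → f :* g :* m := f :* m :* g) refl f g ⟦ models D ⟧) ⟩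
  ⟦ 2 ⟧ * (f * ⟦ models D ⟧ * g)        ≡⟨ cong (λ t → ⟦ 2 ⟧ * (t * g)) (frac-R D v) ⟩
  ⟦ 2 ⟧ * (⟦ a ⟧ * g)                   ≡⟨ *-assoc ⟦ 2 ⟧ ⟦ a ⟧ g ⟨
  ⟦ 2 ⟧ * ⟦ a ⟧ * g                     ≡⟨ cong (_* g) (⟦⟧-double a) ⟨
  ⟦ a ℕ.+ a ⟧ * g                       ≡⟨ cong (λ m → ⟦ m ⟧ * g) (models-pin v D) ⟨
  ⟦ models (D -ᵛ v) ⟧ * g               ≡⟨ *-comm ⟦ models (D -ᵛ v) ⟧ g ⟩
  g * ⟦ models (D -ᵛ v) ⟧               ≡⟨ innerProd-falsifying (D -ᵛ v) ws uws ⟩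
  ⟦ falsifying (D -ᵛ v) ws ⟧            ≡⟨ cong ⟦_⟧ (falsifying-pin v D ws v∉ws) ⟩
  ⟦ z ℕ.+ z ⟧                           ≡⟨ ⟦⟧-double z ⟩
  ⟦ 2 ⟧ * ⟦ z ⟧                         ∎)
  where
  open ≡-Reasoning
  f = frac (R D v)
  g = innerProd (D -ᵛ v) ws
  a = count D v false
  z = falsifying D (v ∷ ws)

-- The outer product over the remaining clauses c_j,…,c_d is the fraction of the
-- models of the x-free clauses W that survive adding c_j - x, …, c_d - x:
-- factor j is 1 minus the probability that c_j - x is falsified.
outerProd-models : ∀ {n} (C : Formula n) x L → All Unique L →
  outerProd C x L * ⟦ models (without C x) ⟧ ≡ ⟦ models (CjMinusCj C x L) ⟧
outerProd-models C x [] _ =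
  trans (*-identityˡ _) (cong (λ D → ⟦ models D ⟧) (sym (++-identityʳ (without C x))))
outerProd-models C x (c ∷ L) (uc ∷ uL) = begin
  (1ℚ - q) * o * ⟦ models W ⟧                  ≡⟨ *-assoc (1ℚ - q) o ⟦ models W ⟧ ⟩
  (1ℚ - q) * (o * ⟦ models W ⟧)                ≡⟨ cong ((1ℚ - q) *_) (outerProd-models C x L uL) ⟩
  (1ℚ - q) * ⟦ models E ⟧                      ≡⟨ solve 2 (λ q m → (con 1ℚ :- q) :* m := m :- q :* m) refl q ⟦ models E ⟧ ⟩
  ⟦ models E ⟧ - q * ⟦ models E ⟧              ≡⟨ cong₂ _-_ (cong ⟦_⟧ (models-add-clause W M c′))
                                                           (innerProd-falsifying E c′ (Uniqueₚ.filter⁺ _ uc)) ⟩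
  ⟦ z ℕ.+ models (W ++ c′ ∷ M) ⟧ - ⟦ z ⟧       ≡⟨ cong (_- ⟦ z ⟧) (⟦⟧-+ z _) ⟩
  ⟦ z ⟧ + ⟦ models (W ++ c′ ∷ M) ⟧ - ⟦ z ⟧     ≡⟨ solve 2 (λ z m → z :+ m :- z := m) refl ⟦ z ⟧ _ ⟩
  ⟦ models (W ++ c′ ∷ M) ⟧                     ∎
  where
  open ≡-Reasoning
  W = without C x
  M = map (_-ᶜ x) L
  E = CjMinusCj C x L
  c′ = c -ᶜ x
  q = innerProd E c′
  o = outerProd C x L
  z = falsifying E c′

-- Scaled by #{models of C with x = 1}, the right-hand side is #{models with x = 0}:
-- W has 2·#{x = 1} models and C - x has 2·#{x = 0}.
rhs-scaled : ∀ {n} (C : Formula n) x → All Unique C →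
  rhs C x * ⟦ count C x true ⟧ ≡ ⟦ count C x false ⟧
rhs-scaled C x unique = *-cancelˡ-⟦suc⟧ 1 (begin
  ⟦ 2 ⟧ * (rhs C x * ⟦ b ⟧)                ≡⟨ solve 3 (λ t r b → t :* (r :* b) := r :* (t :* b)) refl ⟦ 2 ⟧ (rhs C x) ⟦ b ⟧ ⟩
  rhs C x * (⟦ 2 ⟧ * ⟦ b ⟧)                ≡⟨ cong (rhs C x *_) (⟦⟧-double b) ⟨
  rhs C x * ⟦ b ℕ.+ b ⟧                    ≡⟨ cong (λ m → rhs C x * ⟦ m ⟧) (models-without C x) ⟨
  rhs C x * ⟦ models (without C x) ⟧       ≡⟨ outerProd-models C x (withX C x) (Allₚ.filter⁺ _ unique) ⟩
  ⟦ models (CjMinusCj C x (withX C x)) ⟧   ≡⟨ cong ⟦_⟧ (models-pin-all C x) ⟩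
  ⟦ a ℕ.+ a ⟧                              ≡⟨ ⟦⟧-double a ⟩
  ⟦ 2 ⟧ * ⟦ a ⟧                            ∎)
  where
  open ≡-Reasoning
  a = count C x false
  b = count C x true

mainTheorem6 : ∀ {n : ℕ} (C : Formula n) (x : Fin n)
    → All Unique C
    → All (λ c → c ≢ []) C
    → Any (λ c → x ∈ c) C
    → R C x ≡ rhs C x
mainTheorem6 C x unique nonempty _ = begin
  R C x                                      ≡⟨ R≡ratio C x ⟩
  ratio (count C x false) (count C x true)   ≡⟨ ratio-unique _ _ (count-positive C x nonempty) (rhs-scaled C x unique) ⟩
  rhs C x                                    ∎
  where open ≡-Reasoning
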